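{- Let $(\mathcal{M},\sqsubseteq,d)$ be a metric subset space. Let $O_p,O_r\in\mathcal{M}$ with $O_p\sqsubseteq O_r$, let $r(O_r)\geq 0$, and let $\mathcal{T}\subseteq\mathcal{M}$ be a set of objects such that every $O_j\in\mathcal{T}$ satisfies $O_r\sqsubseteq O_j$ and $d(O_r,O_j)\leq r(O_r)$. Let $Q\in\mathcal{M}$ and $r(Q)\geq 0$. If $d(O_p,Q) > r(Q)+r(O_r)+d(O_p,O_r)$, then $d(O_j,Q) > r(Q)$ for every $O_j\in\mathcal{T}$ with $O_j\sqsubseteq Q$.
   Context: A total preorder on a set $\mathcal{M}$ is a reflexive, total and transitive relation. A metric subset space is a triple $(\mathcal{M},\sqsubseteq,d)$ with $\sqsubseteq$ a total preorder on $\mathcal{M}$ and $d:\mathcal{M}\times\mathcal{M}\to\mathbb{R}^{\geq 0}$ satisfying (S1) $d(x,z)\leq d(x,y)+d(y,z)$ for all $x,y,z$ with $x\sqsubseteq y\sqsubseteq z$, and (S2) $d(x,y)=0$ if and only if $x=y$. In the paper's index structure (SuperM-Tree), $O_r$ is a routing object with covering radius $r(O_r)$, $O_p$ is its parent routing object, and $\mathcal{T}$ is the set of objects in the covered subtree of $O_r$; the structure guarantees the stated conditions. -}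

module Defs where

open import Data.Product using (Σ; ∃; _×_)
open import Relation.Binary.PropositionalEquality using (_≡_; _≢_)
open import Relation.Binary.Structures using (IsTotalOrder; IsTotalPreorder)
open import Algebra.Structures using (IsCommutativeRing)

-- The real numbers, axiomatised as a (Dedekind-)complete ordered field.
-- (agda-stdlib has no real numbers; any model of this record is ℝ up to
-- unique isomorphism, and the theorem is quantified over all models.)
record RealNumbers : Set₁ where
  infixl 6 _+_
  infixl 7 _*_
  infix 4 _≤_ _<_
  field
    ℝ : Set
    0ℝ 1ℝ : ℝ
    _+_ _*_ : ℝ → ℝ → ℝ
    -_ : ℝ → ℝ
    _≤_ : ℝ → ℝ → Set
    isCommutativeRing : IsCommutativeRing _≡_ _+_ _*_ -_ 0ℝ 1ℝ
    0≢1 : 0ℝ ≢ 1ℝ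
    inverse : ∀ x → x ≢ 0ℝ → Σ ℝ (λ y → x * y ≡ 1ℝ)
    isTotalOrder : IsTotalOrder _≡_ _≤_
    +-monoˡ-≤ : ∀ {x y} z → x ≤ y → x + z ≤ y + z
    *-nonneg : ∀ {x y} → 0ℝ ≤ x → 0ℝ ≤ y → 0ℝ ≤ x * y
    sup : (P : ℝ → Set) → ∃ P → Σ ℝ (λ b → ∀ x → P x → x ≤ b) →
          Σ ℝ (λ s → (∀ x → P x → x ≤ s) × (∀ b → (∀ x → P x → x ≤ b) → s ≤ b))

  _<_ : ℝ → ℝ → Set
  x < y = (x ≤ y) × (x ≢ y)

record MetricSubsetSpace (R : RealNumbers) : Set₁ where
  open RealNumbers R
  field
    M : Set
    _⊑_ : M → M → Set
    ⊑-isTotalPreorder : IsTotalPreorder _≡_ _⊑_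
    d : M → M → ℝ
    d-nonneg : ∀ x y → 0ℝ ≤ d x y
    S1 : ∀ x y z → x ⊑ y → y ⊑ z → d x z ≤ d x y + d y z
    S2 : ∀ x y → (d x y ≡ 0ℝ → x ≡ y) × (x ≡ y → d x y ≡ 0ℝ)

module Submission where

-- Suppose the query ball (Q, rQ)
-- contained an object Oj of the subtree under Or with Oj ⊑ Q.  The
-- ⊑-chain Op ⊑ Or ⊑ Oj ⊑ Q lets us apply the restricted triangle
-- inequality (S1) twice, giving
--   d Op Q ≤ d Op Or + d Or Oj + d Oj Q ≤ d Op Or + rOr + rQ,
-- which contradicts the hypothesis rQ + rOr + d Op Or < d Op Q.  Since
-- the order on ℝ is total, "not d Oj Q ≤ rQ" yields rQ < d Oj Q.

open import Defs
open import Data.Product using (_×_; _,_)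
open import Data.Sum using (inj₁; inj₂)
open import Data.Empty using (⊥-elim)
open import Relation.Nullary using (¬_)
open import Relation.Binary.PropositionalEquality using (_≡_; subst; sym; cong; module ≡-Reasoning)
open import Relation.Binary.Structures using (IsTotalOrder; IsTotalPreorder)
open import Algebra.Structures using (IsCommutativeRing)

module OrderedField (R : RealNumbers) where
  open RealNumbers R
  open IsCommutativeRing isCommutativeRing using (+-comm)
  open IsTotalOrder isTotalOrder using (total; antisym; reflexive)
    renaming (trans to ≤-trans)

  +-monoʳ-≤ : ∀ {x y} z → x ≤ y → z + x ≤ z + y
  +-monoʳ-≤ {x} {y} z x≤y =
    subst (_≤ z + y) (+-comm x z) (subst (x + z ≤_) (+-comm y z) (+-monoˡ-≤ z x≤y))

  +-mono-≤ : ∀ {x y u v} → x ≤ y → u ≤ v → x + u ≤ y + v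
  +-mono-≤ {y = y} {u = u} x≤y u≤v = ≤-trans (+-monoˡ-≤ u x≤y) (+-monoʳ-≤ y u≤v)

  ≰⇒> : ∀ {x y} → ¬ (y ≤ x) → x < y
  ≰⇒> {x} {y} y≰x with total x y
  ... | inj₂ y≤x = ⊥-elim (y≰x y≤x)
  ... | inj₁ x≤y = x≤y , λ x≡y → y≰x (reflexive (sym x≡y))

  <⇒≱ : ∀ {x y} → x < y → ¬ (y ≤ x)
  <⇒≱ (x≤y , x≢y) y≤x = x≢y (antisym x≤y y≤x)

module ChainTriangle {R : RealNumbers} (S : MetricSubsetSpace R) where
  open RealNumbers R
  open MetricSubsetSpace S
  open OrderedField R
  open IsTotalOrder isTotalOrder using () renaming (trans to ≤-trans)
  open IsTotalPreorder ⊑-isTotalPreorder using () renaming (trans to ⊑-trans)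

  -- (S1) iterated along a ⊑-chain w ⊑ x ⊑ y ⊑ z; intermediate points must
  -- be ⊑-ordered because the triangle inequality only holds for such triples.
  triangle₃ : ∀ w x y z → w ⊑ x → x ⊑ y → y ⊑ z →
              d w z ≤ d w x + (d x y + d y z)
  triangle₃ w x y z w⊑x x⊑y y⊑z =
    ≤-trans (S1 w x z w⊑x (⊑-trans x⊑y y⊑z))
            (+-monoʳ-≤ (d w x) (S1 x y z x⊑y y⊑z))

lemma2 : (R : RealNumbers) (S : MetricSubsetSpace R) →
         let open RealNumbers R in
         let open MetricSubsetSpace S in
         (Op Or : M) → Op ⊑ Or →
         (rOr : ℝ) → 0ℝ ≤ rOr →
         (T : M → Set) →
         (∀ Oj → T Oj → (Or ⊑ Oj) × (d Or Oj ≤ rOr)) →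
         (Q : M) (rQ : ℝ) → 0ℝ ≤ rQ →
         rQ + rOr + d Op Or < d Op Q →
         ∀ Oj → T Oj → Oj ⊑ Q → rQ < d Oj Q
lemma2 R S Op Or Op⊑Or rOr _ T covered Q rQ _ far Oj Oj∈T Oj⊑Q
  with covered Oj Oj∈T
... | Or⊑Oj , dOrOj≤rOr = ≰⇒> (λ dOjQ≤rQ → <⇒≱ far (bound dOjQ≤rQ))
  where
  open RealNumbers R
  open MetricSubsetSpace S
  open OrderedField R
  open ChainTriangle S
  open IsCommutativeRing isCommutativeRing using (+-comm)
  open IsTotalOrder isTotalOrder using () renaming (trans to ≤-trans)

  reorder : d Op Or + (rOr + rQ) ≡ rQ + rOr + d Op Or
  reorder = begin
    d Op Or + (rOr + rQ)  ≡⟨ +-comm (d Op Or) (rOr + rQ) ⟩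
    rOr + rQ + d Op Or    ≡⟨ cong (_+ d Op Or) (+-comm rOr rQ) ⟩
    rQ + rOr + d Op Or    ∎
    where open ≡-Reasoning

  bound : d Oj Q ≤ rQ → d Op Q ≤ rQ + rOr + d Op Or
  bound dOjQ≤rQ =
    subst (d Op Q ≤_) reorder
      (≤-trans (triangle₃ Op Or Oj Q Op⊑Or Or⊑Oj Oj⊑Q)
               (+-monoʳ-≤ (d Op Or) (+-mono-≤ dOrOj≤rOr dOjQ≤rQ)))
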